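{- (a) For every $n\ge 2$, $rc^*(\overleftrightarrow{P_n}) = src^*(\overleftrightarrow{P_n}) = n-1$. (b) For every $n\ge 4$, $rc^*(\overleftrightarrow{C_n}) = src^*(\overleftrightarrow{C_n}) = \lceil n/2\rceil$. (c) Let $k\ge 2$ and let $\overleftrightarrow{K}_{n_1,\dots,n_k}$ be the biorientation of the complete $k$-partite graph $K_{n_1,\dots,n_k}$, where $n_i\ge 2$ for some $i$. Then $rc^*(\overleftrightarrow{K}_{n_1,\dots,n_k}) = src^*(\overleftrightarrow{K}_{n_1,\dots,n_k}) = 2$.
   Context: $P_n$ and $C_n$ denote the path and cycle on $n$ vertices. The biorientation $\overleftrightarrow{G}$ of a graph $G$ is the digraph obtained by replacing each edge $uv$ by the two arcs $uv$ and $vu$. For an arc-colouring of a strongly connected digraph $D$, a directed path is rainbow if no two of its arcs have the same colour. $rc^*(D)$ is the minimum number of colours in an arc-colouring such that for every ordered pair of distinct vertices $x,y$ there is a rainbow directed $xy$-path. $src^*(D)$ is the minimum number of colours in an arc-colouring such that for every ordered pair of distinct vertices $x,y$ there is a rainbow directed $xy$-path of length equal to the directed distance $d_D(x,y)$. -}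

module Defs where

open import Level using (Level; 0ℓ)
open import Data.Bool using (Bool; true; false; T; not; _∧_; _∨_)
open import Data.Nat using (ℕ; zero; suc; _+_; _∸_; _≤_; _≡ᵇ_)
open import Data.Fin using (Fin; toℕ)
open import Data.Fin.Properties using () renaming (_≟_ to _≟F_)
open import Data.List using (List; []; _∷_; length)
open import Data.List.Relation.Unary.Unique.Propositional using (Unique)
open import Data.Product using (Σ; ∃; _×_; _,_)
open import Relation.Binary.PropositionalEquality using (_≡_; _≢_)
open import Relation.Nullary.Decidable using (⌊_⌋)

record Digraph : Set₁ where
  field
    V   : Set
    arc : V → V → Bool
open Digraph public

data Walk (D : Digraph) : V D → V D → Set where
  stop : (x : V D) → Walk D x x
  step : {x y z : V D} → T (arc D x y) → Walk D y z → Walk D x z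

vertices : {D : Digraph} {x y : V D} → Walk D x y → List (V D)
vertices (stop x) = x ∷ []
vertices (step {x = x} _ w) = x ∷ vertices w

len : {D : Digraph} {x y : V D} → Walk D x y → ℕ
len (stop _) = 0
len (step _ w) = suc (len w)

-- An arc-colouring with (at most) k colours: each arc u→v receives a colour
-- in Fin k (values on non-arcs are irrelevant).
Colouring : Digraph → ℕ → Set
Colouring D k = V D → V D → Fin k

colours : {D : Digraph} {k : ℕ} → Colouring D k → {x y : V D} → Walk D x y → List (Fin k)
colours c (stop _) = []
colours c (step {x = x} {y = y} _ w) = c x y ∷ colours c w

IsPath : {D : Digraph} {x y : V D} → Walk D x y → Set
IsPath w = Unique (vertices w)

Rainbow : {D : Digraph} {k : ℕ} → Colouring D k → {x y : V D} → Walk D x y → Set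
Rainbow c w = Unique (colours c w)

IsGeodesic : {D : Digraph} {x y : V D} → Walk D x y → Set
IsGeodesic {D} {x} {y} w = (w' : Walk D x y) → IsPath w' → len w ≤ len w'

RainbowConnected : (D : Digraph) {k : ℕ} → Colouring D k → Set
RainbowConnected D c = (x y : V D) → x ≢ y →
  Σ (Walk D x y) λ w → IsPath w × Rainbow c w

StronglyRainbowConnected : (D : Digraph) {k : ℕ} → Colouring D k → Set
StronglyRainbowConnected D c = (x y : V D) → x ≢ y →
  Σ (Walk D x y) λ w → IsPath w × IsGeodesic w × Rainbow c w

RcStar : Digraph → ℕ → Set
RcStar D k = (Σ (Colouring D k) λ c → RainbowConnected D c)
           × ((m : ℕ) (c : Colouring D m) → RainbowConnected D c → k ≤ m)

SrcStar : Digraph → ℕ → Set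
SrcStar D k = (Σ (Colouring D k) λ c → StronglyRainbowConnected D c)
            × ((m : ℕ) (c : Colouring D m) → StronglyRainbowConnected D c → k ≤ m)

BiPath : ℕ → Digraph
BiPath n = record
  { V = Fin n
  ; arc = λ i j → (suc (toℕ i) ≡ᵇ toℕ j) ∨ (suc (toℕ j) ≡ᵇ toℕ i) }

-- Biorientation of the cycle C_n on vertices 0..n-1
-- (edges i ~ i+1 and 0 ~ n-1)
BiCycle : ℕ → Digraph
BiCycle n = record
  { V = Fin n
  ; arc = λ i j → (suc (toℕ i) ≡ᵇ toℕ j) ∨ (suc (toℕ j) ≡ᵇ toℕ i)
                ∨ ((toℕ i ≡ᵇ 0) ∧ (suc (toℕ j) ≡ᵇ n))
                ∨ ((toℕ j ≡ᵇ 0) ∧ (suc (toℕ i) ≡ᵇ n)) }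

-- Biorientation of the complete k-partite graph K_{n_1,...,n_k}:
-- vertices are pairs (part i, index a < n_i); adjacent iff in different parts.
BiMultipartite : (k : ℕ) → (Fin k → ℕ) → Digraph
BiMultipartite k ns = record
  { V = Σ (Fin k) (λ i → Fin (ns i))
  ; arc = λ { (i , _) (j , _) → not ⌊ i ≟F j ⌋ } }

-- Lower bounds: a rainbow path has no more arcs than there are colours, while a
-- potential that drops by at most one along each arc (a graph distance) bounds the
-- length of every walk from below.  For the odd cycle with N = 2t + 1 and only t
-- colours more is needed: the rainbow path from s to s + t must then be the
-- clockwise one, so any t consecutive clockwise arcs carry all t colours; hence each
-- arc colour recurs t arcs later, and as 2t + 1 = N the arcs at 0 and at 1 would
-- share a colour.
-- Upper bounds: colour the edge {i, i + 1} of the path by i and of the cycle by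
-- i mod ⌈N/2⌉, and an arc of the multipartite graph by whether it goes up or down in
-- the order of the parts; then the monotone path, the shorter way round the cycle,
-- and a single arc or a detour through another part are rainbow geodesics.

module Submission where

open import Defs
open import Algebra.Bundles using (CommutativeMonoid)
open import Data.Bool using (Bool; T; _∨_; _∧_)
open import Data.Bool.Properties using (T-∨; T-∧; ∨-comm; ∨-commutativeMonoid)
open import Data.Fin as F using (Fin; toℕ; fromℕ<)
import Data.Fin.Properties as FP
open import Data.List using (List; []; _∷_; _∷ʳ_; length; lookup; reverse; applyUpTo)
open import Data.List.Membership.Propositional.Properties using (∈-lookup)
open import Data.List.Properties using (length-applyUpTo; unfold-reverse)
open import Data.List.Relation.Unary.All as All using ([]; _∷_)
import Data.List.Relation.Unary.All.Properties as AllProperties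
open import Data.List.Relation.Unary.AllPairs using ([]; _∷_)
open import Data.List.Relation.Unary.Unique.Propositional using (Unique)
open import Data.List.Relation.Unary.Unique.Propositional.Properties using (applyUpTo⁺₁)
open import Data.Nat
open import Data.Nat.DivMod
open import Data.Nat.GeneralisedArithmetic using (iterate)
open import Data.Nat.Properties
open import Data.Nat.Tactic.RingSolver using (solve-∀)
open import Data.Product using (Σ; ∃; _×_; _,_; proj₁; proj₂)
open import Data.Sum using (_⊎_; inj₁; inj₂; [_,_]′)
open import Function using (_∘_; Equivalence)
open import Relation.Binary.PropositionalEquality
open import Relation.Binary using (tri<; tri≈; tri>)
open import Relation.Nullary using (¬_; yes; no; contradiction)

T-∨ˡ : ∀ {x y} → T x → T (x ∨ y)
T-∨ˡ = Equivalence.from T-∨ ∘ inj₁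

T-∨ʳ : ∀ {x y} → T y → T (x ∨ y)
T-∨ʳ = Equivalence.from T-∨ ∘ inj₂

DistinctBelow : {A : Set} → (ℕ → A) → ℕ → Set
DistinctBelow f n = ∀ {i j} → i < j → j < n → f i ≢ f j

module _ {A : Set} where
  open import Data.List.Relation.Binary.Permutation.Setoid (setoid A) using (↭-sym)
  open import Data.List.Relation.Binary.Permutation.Setoid.Properties (setoid A)
    using (Unique-resp-↭; ↭-reverse)

  unique-reverse : {xs : List A} → Unique xs → Unique (reverse xs)
  unique-reverse {xs} = Unique-resp-↭ (↭-sym (↭-reverse xs))

  unique-lookup : {xs : List A} → Unique xs →
                  {i j : Fin (length xs)} → i F.< j → lookup xs i ≢ lookup xs j
  unique-lookup (x∉xs ∷ _)  {F.zero}  {F.suc j} _         = All.lookup x∉xs (∈-lookup j)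
  unique-lookup (_ ∷ xs!)   {F.suc i} {F.suc j} (s<s i<j) = unique-lookup xs! i<j

  unique-applyUpTo⁻ : (f : ℕ → A) (n : ℕ) → Unique (applyUpTo f n) → DistinctBelow f n
  unique-applyUpTo⁻ f (suc n) (f0∉ ∷ _)  {zero}  {suc j} _         (s<s j<n) =
    AllProperties.applyUpTo⁻ (f ∘ suc) n f0∉ j<n
  unique-applyUpTo⁻ f (suc n) (_ ∷ rest!) {suc i} {suc j} (s<s i<j) (s<s j<n) =
    unique-applyUpTo⁻ (f ∘ suc) n rest! i<j j<n

unique-length≤ : ∀ {m} {xs : List (Fin m)} → Unique xs → length xs ≤ m
unique-length≤ {m} {xs} xs! with length xs ≤? m
... | yes ≤m = ≤m
... | no ≰m = let (i , j , i<j , same) = FP.pigeonhole (≰⇒> ≰m) (lookup xs)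
              in contradiction same (unique-lookup xs! i<j)

distinctBelow⇒≤ : ∀ {m} (g : ℕ → Fin m) n → DistinctBelow g n → n ≤ m
distinctBelow⇒≤ g n g! =
  subst (_≤ _) (length-applyUpTo g n) (unique-length≤ (applyUpTo⁺₁ g n g!))

-- Both windows exhaust Fin n, so g n is the one value missing among g 1, …, g (n - 1).
distinct-windows⇒periodic : ∀ {n} (g : ℕ → Fin n) →
  DistinctBelow g n → DistinctBelow (g ∘ suc) n → g 0 ≡ g n
distinct-windows⇒periodic {n} g first! second! with g 0 F.≟ g n
... | yes same = same
... | no differ = contradiction (distinctBelow⇒≤ g (suc n) all!) 1+n≰n
  where
  all! : DistinctBelow g (suc n)
  all! {zero}  {suc j} _         (s<s j<n) with m≤n⇒m<n∨m≡n j<n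
  ... | inj₁ 1+j<n = first! z<s 1+j<n
  ... | inj₂ refl  = differ
  all! {suc i} {suc j} (s<s i<j) (s<s j<n) = second! i<j j<n

[m+n%d]%d≡[m+n]%d : ∀ m n d .{{_ : NonZero d}} → (m + n % d) % d ≡ (m + n) % d
[m+n%d]%d≡[m+n]%d m n d = begin
  (m + n % d) % d          ≡⟨ %-distribˡ-+ m (n % d) d ⟩
  (m % d + n % d % d) % d  ≡⟨ cong (λ x → (m % d + x) % d) (m%n%n≡m%n n d) ⟩
  (m % d + n % d) % d      ≡⟨ %-distribˡ-+ m n d ⟨
  (m + n) % d              ∎
  where open ≡-Reasoning

[m%d+n]%d≡[m+n]%d : ∀ m n d .{{_ : NonZero d}} → (m % d + n) % d ≡ (m + n) % d
[m%d+n]%d≡[m+n]%d m n d = begin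
  (m % d + n) % d  ≡⟨ cong (_% d) (+-comm (m % d) n) ⟩
  (n + m % d) % d  ≡⟨ [m+n%d]%d≡[m+n]%d n m d ⟩
  (n + m) % d      ≡⟨ cong (_% d) (+-comm n m) ⟩
  (m + n) % d      ∎
  where open ≡-Reasoning

[m+n]%o≢m : ∀ {m n o} .{{_ : NonZero o}} → m < o → 0 < n → n < o → (m + n) % o ≢ m
[m+n]%o≢m {m} {n} {o} m<o 0<n n<o with m + n <? o
... | yes m+n<o = λ eq → <⇒≢ (m<m+n m 0<n) (sym (trans (sym (m<n⇒m%n≡m m+n<o)) eq))
... | no m+n≮o = λ eq → <⇒≢ wrapped<m (trans (sym wrapped) eq)
  where
  o≤m+n : o ≤ m + n
  o≤m+n = ≮⇒≥ m+n≮o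
  wrapped : (m + n) % o ≡ m + n ∸ o
  wrapped = trans (sym (m≤n⇒[n∸m]%m≡n%m o≤m+n))
                  (m<n⇒m%n≡m (m<n+o⇒m∸n<o (m + n) o (+-mono-< m<o n<o)))
  wrapped<m : m + n ∸ o < m
  wrapped<m = subst (m + n ∸ o <_) (m+n∸n≡m m o) (∸-monoˡ-< (+-monoʳ-< m n<o) o≤m+n)

0<n<o⇒[m+n]%o≢m%o : ∀ m {n o} .{{_ : NonZero o}} → 0 < n → n < o → (m + n) % o ≢ m % o
0<n<o⇒[m+n]%o≢m%o m {n} {o} 0<n n<o eq =
  [m+n]%o≢m (m%n<n m o) 0<n n<o (trans ([m%d+n]%d≡[m+n]%d m n o) eq)

o<n<2o⇒[m+n]%o≢m%o : ∀ m {n o} .{{_ : NonZero o}} → o < n → n < o + o → (m + n) % o ≢ m % o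
o<n<2o⇒[m+n]%o≢m%o m {n} {o} o<n n<2o eq =
  0<n<o⇒[m+n]%o≢m%o m (m<n⇒0<n∸m o<n) (m<n+o⇒m∸n<o n o n<2o) (begin
    (m + (n ∸ o)) % o      ≡⟨ [m+n]%n≡m%n _ o ⟨
    (m + (n ∸ o) + o) % o  ≡⟨ cong (_% o) (+-assoc m (n ∸ o) o) ⟩
    (m + (n ∸ o + o)) % o  ≡⟨ cong (λ x → (m + x) % o) (m∸n+n≡m (<⇒≤ o<n)) ⟩
    (m + n) % o            ≡⟨ eq ⟩
    m % o                  ∎)
  where open ≡-Reasoning

m+m≤1+n+n⇒m≤n : ∀ {m n} → m + m ≤ suc (n + n) → m ≤ n
m+m≤1+n+n⇒m≤n {m} {n} le = ≮⇒≥ λ n<m →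
  1+n≰n (≤-trans (≤-reflexive (cong suc (sym (+-suc n n)))) (≤-trans (+-mono-≤ n<m n<m) le))

m+m≤n⇒m<n : ∀ {m n} → 0 < n → m + m ≤ n → m < n
m+m≤n⇒m<n {zero}  0<n _    = 0<n
m+m≤n⇒m<n {suc m} _   2m≤n = <-≤-trans (m<m+n (suc m) z<s) 2m≤n

∣m-n∣≡1 : ∀ {m n} → suc m ≡ n ⊎ suc n ≡ m → ∣ m - n ∣ ≡ 1
∣m-n∣≡1 {m}     (inj₁ refl) = trans (m≤n⇒∣m-n∣≡n∸m (n≤1+n m)) (m+n∸n≡m 1 m)
∣m-n∣≡1 {n = n} (inj₂ refl) = trans (m≤n⇒∣n-m∣≡n∸m (n≤1+n n)) (m+n∸n≡m 1 n)

[n+1]/2-double : ∀ n → let q = (n + 1) / 2 in q + q ≡ n ⊎ q + q ≡ suc n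
[n+1]/2-double n = by-remainder ((n + 1) % 2) (m%n<n (n + 1) 2)
  (trans (m≡m%n+[m/n]*n (n + 1) 2) (cong ((n + 1) % 2 +_) q*2≡q+q))
  where
  q : ℕ
  q = (n + 1) / 2
  q*2≡q+q : q * 2 ≡ q + q
  q*2≡q+q = trans (*-comm q 2) (cong (q +_) (+-identityʳ q))
  by-remainder : ∀ r → r < 2 → n + 1 ≡ r + (q + q) → q + q ≡ n ⊎ q + q ≡ suc n
  by-remainder 0 _ eq = inj₂ (trans (sym eq) (+-comm n 1))
  by-remainder 1 _ eq = inj₁ (suc-injective (trans (sym eq) (+-comm n 1)))
  by-remainder (suc (suc _)) (s≤s (s≤s ())) _

-- Without wrap-around p + e and p differ by 0 < e < m; across it they differ by
-- N - e, which lies strictly between m and 2m.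
window-residues-distinct : ∀ {N m d p e} .{{_ : NonZero N}} .{{_ : NonZero m}} →
  N ≤ m + m → m + m ≤ suc N → d + d ≤ N → p < N → 0 < e → e < d → (p + e) % N % m ≢ p % m
window-residues-distinct {N} {m} {d} {p} {e} N≤2m 2m≤1+N 2d≤N p<N 0<e e<d with p + e <? N
... | yes unwrapped =
  subst (λ x → x % m ≢ p % m) (sym (m<n⇒m%n≡m unwrapped)) (0<n<o⇒[m+n]%o≢m%o p 0<e e<m)
  where
  e<m : e < m
  e<m = <-≤-trans e<d (m+m≤1+n+n⇒m≤n (≤-trans (≤-trans 2d≤N N≤2m) (n≤1+n _)))
... | no wrapped = λ eq → o<n<2o⇒[m+n]%o≢m%o q m<s s<2m (begin
    (q + s) % m      ≡⟨ cong (_% m) p≡q+s ⟨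
    p % m            ≡⟨ eq ⟨
    (p + e) % N % m  ≡⟨ cong (_% m) reduce ⟩
    q % m            ∎)
  where
  open ≡-Reasoning
  e<N : e < N
  e<N = <-≤-trans e<d (≤-trans (m≤m+n d d) 2d≤N)
  e≤N : e ≤ N
  e≤N = <⇒≤ e<N
  N≤p+e : N ≤ p + e
  N≤p+e = ≮⇒≥ wrapped
  q s : ℕ
  q = p + e ∸ N
  s = N ∸ e
  reduce : (p + e) % N ≡ q
  reduce = trans (sym (m≤n⇒[n∸m]%m≡n%m N≤p+e)) (m<n⇒m%n≡m (m<n+o⇒m∸n<o (p + e) N (+-mono-< p<N e<N)))
  p≡q+s : p ≡ q + s
  p≡q+s = +-cancelʳ-≡ e p (q + s) (begin
    p + e        ≡⟨ m∸n+n≡m N≤p+e ⟨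
    q + N        ≡⟨ cong (q +_) (m∸n+n≡m e≤N) ⟨
    q + (s + e)  ≡⟨ +-assoc q s e ⟨
    q + s + e    ∎)
  double : ∀ a b → suc (a + b) + suc (a + b) ≡ (a + a) + (suc b + suc b)
  double = solve-∀
  m<s : m < s
  m<s = m+n≤o⇒m≤o∸n (suc m) (m+m≤1+n+n⇒m≤n (subst (_≤ suc (N + N)) (sym (double m e))
          (+-mono-≤ 2m≤1+N (≤-trans (+-mono-≤ e<d e<d) 2d≤N))))
  s<2m : s < m + m
  s<2m = <-≤-trans (∸-monoʳ-< 0<e e≤N) N≤2m

module _ {D : Digraph} where

  RainbowPath : ∀ {k} → Colouring D k → V D → V D → ℕ → Set
  RainbowPath c x y ℓ = Σ (Walk D x y) λ w → IsPath w × Rainbow c w × len w ≡ ℓ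

  Lipschitz : (V D → ℕ) → Set
  Lipschitz f = ∀ u v → T (arc D u v) → f u ≤ suc (f v)

  length-colours : ∀ {k} (c : Colouring D k) {x y} (w : Walk D x y) →
                   length (colours c w) ≡ len w
  length-colours c (stop _)   = refl
  length-colours c (step _ w) = cong suc (length-colours c w)

  rainbow⇒len≤ : ∀ {k} (c : Colouring D k) {x y} (w : Walk D x y) → Rainbow c w → len w ≤ k
  rainbow⇒len≤ c w w! = subst (_≤ _) (length-colours c w) (unique-length≤ w!)

  lipschitz⇒≤len : ∀ {f} → Lipschitz f → ∀ {x y} → f y ≡ 0 → (w : Walk D x y) → f x ≤ len w
  lipschitz⇒≤len L fy≡0 (stop _)   = ≤-reflexive fy≡0
  lipschitz⇒≤len L fy≡0 (step {x} {v} a w) = ≤-trans (L x v a) (s≤s (lipschitz⇒≤len L fy≡0 w))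

  geodesic-if-len≤ : ∀ {f} → Lipschitz f → ∀ {x y} → f y ≡ 0 →
                     (w : Walk D x y) → len w ≤ f x → IsGeodesic w
  geodesic-if-len≤ L fy≡0 w ≤fx w′ _ = ≤-trans ≤fx (lipschitz⇒≤len L fy≡0 w′)

  colours-lower-bound : ∀ {x y d} → x ≢ y → ((w : Walk D x y) → d ≤ len w) →
                        ∀ {k} (c : Colouring D k) → RainbowConnected D c → d ≤ k
  colours-lower-bound x≢y d≤ c rc =
    let (w , _ , w!) = rc _ _ x≢y in ≤-trans (d≤ w) (rainbow⇒len≤ c w w!)

  strong⇒rainbowConnected : ∀ {k} {c : Colouring D k} →
                            StronglyRainbowConnected D c → RainbowConnected D c
  strong⇒rainbowConnected src x y x≢y = let (w , w-path , _ , w!) = src x y x≢y in w , w-path , w!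

  rc*-src*-intro : ∀ {k} (c : Colouring D k) → StronglyRainbowConnected D c →
                   (∀ m (c′ : Colouring D m) → RainbowConnected D c′ → k ≤ m) →
                   RcStar D k × SrcStar D k
  rc*-src*-intro c src lower =
    ((c , strong⇒rainbowConnected src) , lower) ,
    ((c , src) , λ m c′ src′ → lower m c′ (strong⇒rainbowConnected src′))

module Reversal (D : Digraph) (arc-sym : ∀ u v → T (arc D u v) → T (arc D v u)) where

  _▷_ : ∀ {x y z} → Walk D x y → T (arc D y z) → Walk D x z
  stop _   ▷ a = step a (stop _)
  step b w ▷ a = step b (w ▷ a)

  reverseWalk : ∀ {x y} → Walk D x y → Walk D y x
  reverseWalk (stop x)   = stop x
  reverseWalk (step {x} {v} a w) = reverseWalk w ▷ arc-sym x v a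

  len-▷ : ∀ {x y z} (w : Walk D x y) (a : T (arc D y z)) → len (w ▷ a) ≡ suc (len w)
  len-▷ (stop _)   a = refl
  len-▷ (step _ w) a = cong suc (len-▷ w a)

  len-reverse : ∀ {x y} (w : Walk D x y) → len (reverseWalk w) ≡ len w
  len-reverse (stop _)   = refl
  len-reverse (step {x} {v} a w) =
    trans (len-▷ (reverseWalk w) (arc-sym x v a)) (cong suc (len-reverse w))

  vertices-▷ : ∀ {x y z} (w : Walk D x y) (a : T (arc D y z)) → vertices (w ▷ a) ≡ vertices w ∷ʳ z
  vertices-▷ (stop _)   a = refl
  vertices-▷ (step _ w) a = cong (_ ∷_) (vertices-▷ w a)

  vertices-reverse : ∀ {x y} (w : Walk D x y) → vertices (reverseWalk w) ≡ reverse (vertices w)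
  vertices-reverse (stop _) = refl
  vertices-reverse (step {x} {v} a w) = begin
    vertices (reverseWalk w ▷ arc-sym x v a) ≡⟨ vertices-▷ (reverseWalk w) (arc-sym x v a) ⟩
    vertices (reverseWalk w) ∷ʳ x        ≡⟨ cong (_∷ʳ x) (vertices-reverse w) ⟩
    reverse (vertices w) ∷ʳ x            ≡⟨ unfold-reverse x (vertices w) ⟨
    reverse (x ∷ vertices w)             ∎
    where open ≡-Reasoning

  path-reverse : ∀ {x y} (w : Walk D x y) → IsPath w → IsPath (reverseWalk w)
  path-reverse w w-path = subst Unique (sym (vertices-reverse w)) (unique-reverse w-path)

  module _ {k} (c : Colouring D k) (c-sym : ∀ u v → T (arc D u v) → c u v ≡ c v u) where

    colours-▷ : ∀ {x y z} (w : Walk D x y) (a : T (arc D y z)) →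
                colours c (w ▷ a) ≡ colours c w ∷ʳ c y z
    colours-▷ (stop _)   a = refl
    colours-▷ (step _ w) a = cong (_ ∷_) (colours-▷ w a)

    colours-reverse : ∀ {x y} (w : Walk D x y) → colours c (reverseWalk w) ≡ reverse (colours c w)
    colours-reverse (stop _) = refl
    colours-reverse (step {x} {v} a w) = begin
      colours c (reverseWalk w ▷ arc-sym x v a) ≡⟨ colours-▷ (reverseWalk w) (arc-sym x v a) ⟩
      colours c (reverseWalk w) ∷ʳ c v x        ≡⟨ cong₂ _∷ʳ_ (colours-reverse w) (sym (c-sym x v a)) ⟩
      reverse (colours c w) ∷ʳ c x v        ≡⟨ unfold-reverse (c x v) (colours c w) ⟨
      reverse (c x v ∷ colours c w)         ∎
      where open ≡-Reasoning

    rainbow-reverse : ∀ {x y} (w : Walk D x y) → Rainbow c w → Rainbow c (reverseWalk w)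
    rainbow-reverse w w! = subst Unique (sym (colours-reverse w)) (unique-reverse w!)

    strongly-rainbow-connected :
      (δ : V D → V D → ℕ) → (∀ y → Lipschitz (λ u → δ u y)) → (∀ y → δ y y ≡ 0) →
      (∀ x y → x ≢ y → RainbowPath c x y (δ x y) ⊎ RainbowPath c y x (δ x y)) →
      StronglyRainbowConnected D c
    strongly-rainbow-connected δ L δ-self paths x y x≢y with paths x y x≢y
    ... | inj₁ (w , w-path , w! , len≡) =
      w , w-path , geodesic-if-len≤ (L y) (δ-self y) w (≤-reflexive len≡) , w!
    ... | inj₂ (w , w-path , w! , len≡) =
      reverseWalk w , path-reverse w w-path ,
      geodesic-if-len≤ (L y) (δ-self y) (reverseWalk w) (≤-reflexive (trans (len-reverse w) len≡)) ,
      rainbow-reverse w w!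

module Rotation (N : ℕ) .{{_ : NonZero N}} where

  nxt : Fin N → Fin N
  nxt u = suc (toℕ u) mod N

  infixl 6 _⊕_
  _⊕_ : Fin N → ℕ → Fin N
  u ⊕ j = iterate nxt u j

  ⊕-+ : ∀ u i j → u ⊕ (i + j) ≡ u ⊕ i ⊕ j
  ⊕-+ u zero    j = refl
  ⊕-+ u (suc i) j = ⊕-+ (nxt u) i j

  ⊕-suc : ∀ u j → u ⊕ suc j ≡ nxt (u ⊕ j)
  ⊕-suc u j = trans (cong (u ⊕_) (+-comm 1 j)) (⊕-+ u j 1)

  toℕ-⊕ : ∀ u j → toℕ (u ⊕ j) ≡ (toℕ u + j) % N
  toℕ-⊕ u zero = sym (trans (cong (_% N) (+-identityʳ (toℕ u))) (m<n⇒m%n≡m (FP.toℕ<n u)))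
  toℕ-⊕ u (suc j) = begin
    toℕ (nxt u ⊕ j)            ≡⟨ toℕ-⊕ (nxt u) j ⟩
    (toℕ (nxt u) + j) % N      ≡⟨ cong (λ x → (x + j) % N) (FP.toℕ-fromℕ< _) ⟩
    (suc (toℕ u) % N + j) % N  ≡⟨ [m%d+n]%d≡[m+n]%d (suc (toℕ u)) j N ⟩
    (suc (toℕ u) + j) % N      ≡⟨ cong (_% N) (+-suc (toℕ u) j) ⟨
    (toℕ u + suc j) % N        ∎
    where open ≡-Reasoning

  toℕ-⊕-< : ∀ u {j} → toℕ u + j < N → toℕ (u ⊕ j) ≡ toℕ u + j
  toℕ-⊕-< u {j} lt = trans (toℕ-⊕ u j) (m<n⇒m%n≡m lt)

  toℕ-nxt-< : ∀ u → suc (toℕ u) < N → toℕ (nxt u) ≡ suc (toℕ u)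
  toℕ-nxt-< u lt = trans (FP.toℕ-fromℕ< _) (m<n⇒m%n≡m lt)

  toℕ-nxt-last : ∀ u → suc (toℕ u) ≡ N → toℕ (nxt u) ≡ 0
  toℕ-nxt-last u last = trans (FP.toℕ-fromℕ< _) (trans (cong (_% N) last) (n%n≡0 N))

  ⊕-N : ∀ u → u ⊕ N ≡ u
  ⊕-N u = FP.toℕ-injective (begin
    toℕ (u ⊕ N)        ≡⟨ toℕ-⊕ u N ⟩
    (toℕ u + N) % N    ≡⟨ [m+n]%n≡m%n (toℕ u) N ⟩
    toℕ u % N          ≡⟨ m<n⇒m%n≡m (FP.toℕ<n u) ⟩
    toℕ u              ∎)
    where open ≡-Reasoning

  ⊕-≢ : ∀ u {d} → 0 < d → d < N → u ⊕ d ≢ u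
  ⊕-≢ u {d} 0<d d<N eq = [m+n]%o≢m (FP.toℕ<n u) 0<d d<N (trans (sym (toℕ-⊕ u d)) (cong toℕ eq))

  ⊕-≢-< : ∀ u {i j} → i < j → j < N → u ⊕ i ≢ u ⊕ j
  ⊕-≢-< u {i} {j} i<j j<N eq = ⊕-≢ (u ⊕ i) (m<n⇒0<n∸m i<j) (≤-<-trans (m∸n≤m j i) j<N) (begin
    u ⊕ i ⊕ (j ∸ i)    ≡⟨ ⊕-+ u i (j ∸ i) ⟨
    u ⊕ (i + (j ∸ i))  ≡⟨ cong (u ⊕_) (m+[n∸m]≡n (<⇒≤ i<j)) ⟩
    u ⊕ j              ≡⟨ eq ⟨
    u ⊕ i              ∎)
    where open ≡-Reasoning

  ⊕-injective : ∀ u {i j} → i < N → j < N → u ⊕ i ≡ u ⊕ j → i ≡ j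
  ⊕-injective u {i} {j} i<N j<N eq with <-cmp i j
  ... | tri< i<j _ _ = contradiction eq (⊕-≢-< u i<j j<N)
  ... | tri≈ _ i≡j _ = i≡j
  ... | tri> _ _ j<i = contradiction (sym eq) (⊕-≢-< u j<i i<N)

  -- clockwise distance: the number of nxt-steps from u to v
  cwDist : Fin N → Fin N → ℕ
  cwDist u v = (toℕ v + (N ∸ toℕ u)) % N

  cwDist<N : ∀ u v → cwDist u v < N
  cwDist<N u v = m%n<n _ N

  ⊕-cwDist : ∀ u v → u ⊕ cwDist u v ≡ v
  ⊕-cwDist u v = FP.toℕ-injective (begin
    toℕ (u ⊕ cwDist u v)                ≡⟨ toℕ-⊕ u _ ⟩
    (toℕ u + cwDist u v) % N             ≡⟨ [m+n%d]%d≡[m+n]%d (toℕ u) _ N ⟩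
    (toℕ u + (toℕ v + (N ∸ toℕ u))) % N  ≡⟨ cong (_% N) (+-comm (toℕ u) _) ⟩
    (toℕ v + (N ∸ toℕ u) + toℕ u) % N    ≡⟨ cong (_% N) (+-assoc (toℕ v) _ _) ⟩
    (toℕ v + (N ∸ toℕ u + toℕ u)) % N    ≡⟨ cong (λ x → (toℕ v + x) % N) (m∸n+n≡m (<⇒≤ (FP.toℕ<n u))) ⟩
    (toℕ v + N) % N                      ≡⟨ [m+n]%n≡m%n (toℕ v) N ⟩
    toℕ v % N                            ≡⟨ m<n⇒m%n≡m (FP.toℕ<n v) ⟩
    toℕ v                                ∎)
    where open ≡-Reasoning

  cwDist-unique : ∀ {u v j} → j < N → u ⊕ j ≡ v → cwDist u v ≡ j
  cwDist-unique {u} {v} j<N eq = ⊕-injective u (cwDist<N u v) j<N (trans (⊕-cwDist u v) (sym eq))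

  cwDist-⊕ : ∀ u {d} → d < N → cwDist u (u ⊕ d) ≡ d
  cwDist-⊕ u d<N = cwDist-unique d<N refl

  cwDist-self : ∀ u → cwDist u u ≡ 0
  cwDist-self u = cwDist-⊕ u (>-nonZero⁻¹ N)

  cwDist-nxtˡ : ∀ {u v} → u ≢ v → cwDist u v ≡ suc (cwDist (nxt u) v)
  cwDist-nxtˡ {u} {v} u≢v = cwDist-unique (≤∧≢⇒< (cwDist<N (nxt u) v) ≢N) (⊕-cwDist (nxt u) v)
    where
    ≢N : suc (cwDist (nxt u) v) ≢ N
    ≢N eq = u≢v (begin
      u                            ≡⟨ ⊕-N u ⟨
      u ⊕ N                        ≡⟨ cong (u ⊕_) eq ⟨
      u ⊕ suc (cwDist (nxt u) v)   ≡⟨ ⊕-cwDist (nxt u) v ⟩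
      v                            ∎)
      where open ≡-Reasoning

  cwDist-nxtʳ : ∀ {u v} → nxt u ≢ v → cwDist v (nxt u) ≡ suc (cwDist v u)
  cwDist-nxtʳ {u} {v} nxtu≢v = cwDist-unique (≤∧≢⇒< (cwDist<N v u) ≢N) v⊕suc
    where
    v⊕suc : v ⊕ suc (cwDist v u) ≡ nxt u
    v⊕suc = trans (⊕-suc v (cwDist v u)) (cong nxt (⊕-cwDist v u))
    ≢N : suc (cwDist v u) ≢ N
    ≢N eq = nxtu≢v (trans (sym v⊕suc) (trans (cong (v ⊕_) eq) (⊕-N v)))

  cwDist-opposite : ∀ {u v} → u ≢ v → cwDist v u ≡ N ∸ cwDist u v
  cwDist-opposite {u} {v} u≢v = cwDist-unique (∸-monoʳ-< 0<c (<⇒≤ (cwDist<N u v))) (begin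
    v ⊕ (N ∸ c)       ≡⟨ cong (_⊕ (N ∸ c)) (⊕-cwDist u v) ⟨
    u ⊕ c ⊕ (N ∸ c)   ≡⟨ ⊕-+ u c (N ∸ c) ⟨
    u ⊕ (c + (N ∸ c)) ≡⟨ cong (u ⊕_) (m+[n∸m]≡n (<⇒≤ (cwDist<N u v))) ⟩
    u ⊕ N             ≡⟨ ⊕-N u ⟩
    u                 ∎)
    where
    open ≡-Reasoning
    c : ℕ
    c = cwDist u v
    0<c : 0 < c
    0<c = n≢0⇒n>0 λ c≡0 → u≢v (trans (cong (u ⊕_) (sym c≡0)) (⊕-cwDist u v))

  cwDist-sum : ∀ {u v} → u ≢ v → cwDist u v + cwDist v u ≡ N
  cwDist-sum {u} {v} u≢v =
    trans (cong (cwDist u v +_) (cwDist-opposite u≢v)) (m+[n∸m]≡n (<⇒≤ (cwDist<N u v)))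

  dist : Fin N → Fin N → ℕ
  dist u v = cwDist u v ⊓ cwDist v u

  dist-self : ∀ u → dist u u ≡ 0
  dist-self u = cong (λ x → x ⊓ x) (cwDist-self u)

  dist+dist≤N : ∀ {u v} → u ≢ v → dist u v + dist u v ≤ N
  dist+dist≤N {u} {v} u≢v =
    ≤-trans (+-mono-≤ (m⊓n≤m (cwDist u v) (cwDist v u)) (m⊓n≤n (cwDist u v) (cwDist v u)))
            (≤-reflexive (cwDist-sum u≢v))

  dist-⊕ : ∀ u {t} → 0 < t → t + t ≤ N → dist u (u ⊕ t) ≡ t
  dist-⊕ u {t} 0<t t+t≤N = begin
    cwDist u (u ⊕ t) ⊓ cwDist (u ⊕ t) u  ≡⟨ cong₂ _⊓_ (cwDist-⊕ u t<N) (cwDist-opposite u≢u⊕t) ⟩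
    t ⊓ (N ∸ cwDist u (u ⊕ t))            ≡⟨ cong (λ x → t ⊓ (N ∸ x)) (cwDist-⊕ u t<N) ⟩
    t ⊓ (N ∸ t)                           ≡⟨ m≤n⇒m⊓n≡m (m+n≤o⇒m≤o∸n t t+t≤N) ⟩
    t                                     ∎
    where
    open ≡-Reasoning
    t<N : t < N
    t<N = m+m≤n⇒m<n (>-nonZero⁻¹ N) t+t≤N
    u≢u⊕t : u ≢ u ⊕ t
    u≢u⊕t = ⊕-≢ u 0<t t<N ∘ sym

  dist-nxt : 1 < N → ∀ u y → dist u y ≤ suc (dist (nxt u) y) × dist (nxt u) y ≤ suc (dist u y)
  dist-nxt 1<N u y with u F.≟ y | nxt u F.≟ y
  ... | yes refl | _ = ≤-trans (≤-reflexive (dist-self u)) z≤n ,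
                       ≤-trans (m⊓n≤n _ _) (≤-trans (≤-reflexive (cwDist-⊕ u 1<N)) (s≤s z≤n))
  ... | no _ | yes refl = ≤-trans (m⊓n≤m _ _) (≤-trans (≤-reflexive (cwDist-⊕ u 1<N)) (s≤s z≤n)) ,
                          ≤-trans (≤-reflexive (dist-self (nxt u))) z≤n
  ... | no u≢y | no nxtu≢y = adjacent (cwDist-nxtˡ u≢y) (cwDist-nxtʳ nxtu≢y)
    where
    adjacent : ∀ {a b a′ b′} → a ≡ suc a′ → b′ ≡ suc b →
               a ⊓ b ≤ suc (a′ ⊓ b′) × a′ ⊓ b′ ≤ suc (a ⊓ b)
    adjacent {b = b} {a′} refl refl = ⊓-monoʳ-≤ (suc a′) (≤-trans (n≤1+n b) (n≤1+n _)) ,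
                                      ⊓-monoˡ-≤ (suc b) (≤-trans (n≤1+n a′) (n≤1+n _))

module RotationWalks (N : ℕ) .{{_ : NonZero N}} (adj : Fin N → Fin N → Bool) where

  open Rotation N public

  D : Digraph
  D = record { V = Fin N ; arc = adj }

  ClockwiseArcs : Fin N → ℕ → Set
  ClockwiseArcs u d = ∀ {j} → j < d → T (adj (u ⊕ j) (nxt (u ⊕ j)))

  clockwiseWalk : ∀ u d → ClockwiseArcs u d → Walk D u (u ⊕ d)
  clockwiseWalk u zero    arcs = stop u
  clockwiseWalk u (suc d) arcs = step (arcs z<s) (clockwiseWalk (nxt u) d (λ j<d → arcs (s<s j<d)))

  len-clockwiseWalk : ∀ u d (arcs : ClockwiseArcs u d) → len (clockwiseWalk u d arcs) ≡ d
  len-clockwiseWalk u zero    arcs = refl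
  len-clockwiseWalk u (suc d) arcs = cong suc (len-clockwiseWalk (nxt u) d _)

  vertices-clockwiseWalk : ∀ u d (arcs : ClockwiseArcs u d) →
    vertices (clockwiseWalk u d arcs) ≡ applyUpTo (u ⊕_) (suc d)
  vertices-clockwiseWalk u zero    arcs = refl
  vertices-clockwiseWalk u (suc d) arcs = cong (u ∷_) (vertices-clockwiseWalk (nxt u) d _)

  colours-clockwiseWalk : ∀ {k} (c : Colouring D k) u d (arcs : ClockwiseArcs u d) →
    colours c (clockwiseWalk u d arcs) ≡ applyUpTo (λ j → c (u ⊕ j) (nxt (u ⊕ j))) d
  colours-clockwiseWalk c u zero    arcs = refl
  colours-clockwiseWalk c u (suc d) arcs = cong (c u (nxt u) ∷_) (colours-clockwiseWalk c (nxt u) d _)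

  clockwise-rainbowPath : ∀ {k} (c : Colouring D k) u {d} → d < N → (arcs : ClockwiseArcs u d) →
    DistinctBelow (λ j → c (u ⊕ j) (nxt (u ⊕ j))) d → RainbowPath c u (u ⊕ d) d
  clockwise-rainbowPath c u {d} d<N arcs distinct =
    clockwiseWalk u d arcs ,
    subst Unique (sym (vertices-clockwiseWalk u d arcs))
      (applyUpTo⁺₁ _ (suc d) λ i<j j≤d → ⊕-≢-< u i<j (≤-<-trans (s≤s⁻¹ j≤d) d<N)) ,
    subst Unique (sym (colours-clockwiseWalk c u d arcs)) (applyUpTo⁺₁ _ d distinct) ,
    len-clockwiseWalk u d arcs

module PathGraph (n : ℕ) where

  open RotationWalks (2 + n) (arc (BiPath (2 + n)))

  arc⇒succ : ∀ {u v} → T (arc D u v) → suc (toℕ u) ≡ toℕ v ⊎ suc (toℕ v) ≡ toℕ u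
  arc⇒succ a with Equivalence.to T-∨ a
  ... | inj₁ forward  = inj₁ (≡ᵇ⇒≡ _ _ forward)
  ... | inj₂ backward = inj₂ (≡ᵇ⇒≡ _ _ backward)

  succ⇒arc : ∀ {u v} → suc (toℕ u) ≡ toℕ v → T (arc D u v)
  succ⇒arc eq = T-∨ˡ (≡⇒≡ᵇ _ _ eq)

  arc-sym : ∀ u v → T (arc D u v) → T (arc D v u)
  arc-sym u v = subst T (∨-comm (suc (toℕ u) ≡ᵇ toℕ v) (suc (toℕ v) ≡ᵇ toℕ u))

  -- the edge {i, i+1} gets colour i
  colouring : Colouring D (suc n)
  colouring u v = (toℕ u ⊓ toℕ v) mod suc n

  colouring-sym : ∀ u v → T (arc D u v) → colouring u v ≡ colouring v u
  colouring-sym u v _ = cong (_mod suc n) (⊓-comm (toℕ u) (toℕ v))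

  distance : Fin (2 + n) → Fin (2 + n) → ℕ
  distance u v = ∣ toℕ u - toℕ v ∣

  distance-lipschitz : ∀ y → Lipschitz {D} (λ u → distance u y)
  distance-lipschitz y u v a = begin
    ∣ toℕ u - toℕ y ∣                     ≤⟨ ∣-∣-triangle (toℕ u) (toℕ v) (toℕ y) ⟩
    ∣ toℕ u - toℕ v ∣ + ∣ toℕ v - toℕ y ∣  ≡⟨ cong (_+ _) (∣m-n∣≡1 (arc⇒succ {u} {v} a)) ⟩
    suc ∣ toℕ v - toℕ y ∣                 ∎
    where open ≤-Reasoning

  ascending : ∀ {x y} → toℕ x < toℕ y → RainbowPath colouring x y (toℕ y ∸ toℕ x)
  ascending {x} {y} x<y =
    subst (λ z → RainbowPath colouring x z d) x⊕d≡y (clockwise-rainbowPath colouring x d<N arcs distinct)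
    where
    d : ℕ
    d = toℕ y ∸ toℕ x
    x+d≡y : toℕ x + d ≡ toℕ y
    x+d≡y = m+[n∸m]≡n (<⇒≤ x<y)
    d<N : d < 2 + n
    d<N = ≤-<-trans (m∸n≤m (toℕ y) (toℕ x)) (FP.toℕ<n y)
    x+j<y : ∀ {j} → j < d → toℕ x + j < toℕ y
    x+j<y j<d = subst (_ <_) x+d≡y (+-monoʳ-< (toℕ x) j<d)
    position : ∀ {j} → j < d → toℕ (x ⊕ j) ≡ toℕ x + j
    position j<d = toℕ-⊕-< x (<-trans (x+j<y j<d) (FP.toℕ<n y))
    next-position : ∀ {j} → j < d → toℕ (nxt (x ⊕ j)) ≡ suc (toℕ (x ⊕ j))
    next-position {j} j<d = toℕ-nxt-< (x ⊕ j)
      (subst (λ p → suc p < 2 + n) (sym (position j<d)) (≤-<-trans (x+j<y j<d) (FP.toℕ<n y)))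
    arcs : ClockwiseArcs x d
    arcs j<d = succ⇒arc (sym (next-position j<d))
    toℕ-colour : ∀ {j} → j < d → toℕ (colouring (x ⊕ j) (nxt (x ⊕ j))) ≡ toℕ x + j
    toℕ-colour {j} j<d = begin
      toℕ (colouring (x ⊕ j) (nxt (x ⊕ j)))      ≡⟨ FP.toℕ-fromℕ< _ ⟩
      (toℕ (x ⊕ j) ⊓ toℕ (nxt (x ⊕ j))) % suc n  ≡⟨ cong (λ p → (toℕ (x ⊕ j) ⊓ p) % suc n) (next-position j<d) ⟩
      (toℕ (x ⊕ j) ⊓ suc (toℕ (x ⊕ j))) % suc n  ≡⟨ cong (_% suc n) (m≤n⇒m⊓n≡m (n≤1+n (toℕ (x ⊕ j)))) ⟩
      toℕ (x ⊕ j) % suc n                        ≡⟨ cong (_% suc n) (position j<d) ⟩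
      (toℕ x + j) % suc n                        ≡⟨ m<n⇒m%n≡m x+j<1+n ⟩
      toℕ x + j                                  ∎
      where
      open ≡-Reasoning
      x+j<1+n : toℕ x + j < suc n
      x+j<1+n = <-≤-trans (x+j<y j<d) (s≤s⁻¹ (FP.toℕ<n y))
    distinct : DistinctBelow (λ j → colouring (x ⊕ j) (nxt (x ⊕ j))) d
    distinct {i} {j} i<j j<d same = <⇒≢ i<j (+-cancelˡ-≡ (toℕ x) i j
      (trans (sym (toℕ-colour (<-trans i<j j<d))) (trans (cong toℕ same) (toℕ-colour j<d))))
    x⊕d≡y : x ⊕ d ≡ y
    x⊕d≡y = FP.toℕ-injective (trans (toℕ-⊕-< x (subst (_< 2 + n) (sym x+d≡y) (FP.toℕ<n y))) x+d≡y)

  strongly-rainbow-connected-colouring : StronglyRainbowConnected D colouring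
  strongly-rainbow-connected-colouring =
    strongly-rainbow-connected colouring colouring-sym distance distance-lipschitz
      (λ y → ∣n-n∣≡0 (toℕ y)) paths
    where
    open Reversal D arc-sym
    paths : ∀ x y → x ≢ y →
            RainbowPath colouring x y (distance x y) ⊎ RainbowPath colouring y x (distance x y)
    paths x y x≢y with <-cmp (toℕ x) (toℕ y)
    ... | tri< x<y _ _ =
      inj₁ (subst (RainbowPath colouring x y) (sym (m≤n⇒∣m-n∣≡n∸m (<⇒≤ x<y))) (ascending x<y))
    ... | tri≈ _ x≡y _ = contradiction (FP.toℕ-injective x≡y) x≢y
    ... | tri> _ _ y<x =
      inj₂ (subst (RainbowPath colouring y x) (sym (m≤n⇒∣n-m∣≡n∸m (<⇒≤ y<x))) (ascending y<x))

  colours-lower-bound-ends : ∀ k (c : Colouring D k) → RainbowConnected D c → suc n ≤ k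
  colours-lower-bound-ends k c = subst (_≤ k) (FP.toℕ-fromℕ (suc n))
    ∘ colours-lower-bound {x = F.zero} {y = last} (λ ())
        (lipschitz⇒≤len (distance-lipschitz last) (∣n-n∣≡0 (toℕ last))) c
    where
    last : Fin (2 + n)
    last = F.fromℕ (suc n)

  rc*-src* : RcStar (BiPath (2 + n)) (suc n) × SrcStar (BiPath (2 + n)) (suc n)
  rc*-src* = rc*-src*-intro colouring strongly-rainbow-connected-colouring colours-lower-bound-ends

module CycleGraph (N : ℕ) (4≤N : 4 ≤ N) where

  instance
    N-nonZero : NonZero N
    N-nonZero = >-nonZero (≤-trans (s≤s z≤n) 4≤N)

  open RotationWalks N (arc (BiCycle N))

  1<N : 1 < N
  1<N = ≤-trans (s≤s (s≤s z≤n)) 4≤N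

  2<N : 2 < N
  2<N = ≤-trans (s≤s (s≤s (s≤s z≤n))) 4≤N

  -- arc (BiCycle N) u v is forward u v ∨ forward v u ∨ wrap u v ∨ wrap v u
  forward wrap : Fin N → Fin N → Bool
  forward u v = suc (toℕ u) ≡ᵇ toℕ v
  wrap u v = (toℕ u ≡ᵇ 0) ∧ (suc (toℕ v) ≡ᵇ N)

  succ⇒nxt : ∀ {u v} → suc (toℕ u) ≡ toℕ v → v ≡ nxt u
  succ⇒nxt {u} {v} eq =
    FP.toℕ-injective (trans (sym eq) (sym (toℕ-nxt-< u (subst (_< N) (sym eq) (FP.toℕ<n v)))))

  wrap⇒nxt : ∀ {u v} → toℕ v ≡ 0 → suc (toℕ u) ≡ N → v ≡ nxt u
  wrap⇒nxt {u} v≡0 last = FP.toℕ-injective (trans v≡0 (sym (toℕ-nxt-last u last)))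

  arc⇒adjacent : ∀ {u v} → T (arc D u v) → v ≡ nxt u ⊎ u ≡ nxt v
  arc⇒adjacent a with Equivalence.to T-∨ a
  ... | inj₁ fw = inj₁ (succ⇒nxt (≡ᵇ⇒≡ _ _ fw))
  ... | inj₂ a′ with Equivalence.to T-∨ a′
  ...   | inj₁ bw = inj₂ (succ⇒nxt (≡ᵇ⇒≡ _ _ bw))
  ...   | inj₂ a″ with Equivalence.to T-∨ a″
  ...     | inj₁ wr = let (first , last) = Equivalence.to T-∧ wr in
                      inj₂ (wrap⇒nxt (≡ᵇ⇒≡ _ _ first) (≡ᵇ⇒≡ _ _ last))
  ...     | inj₂ wr = let (first , last) = Equivalence.to T-∧ wr in
                      inj₁ (wrap⇒nxt (≡ᵇ⇒≡ _ _ first) (≡ᵇ⇒≡ _ _ last))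

  arc-nxt : ∀ u → T (arc D u (nxt u))
  arc-nxt u with suc (toℕ u) <? N
  ... | yes inside = T-∨ˡ (≡⇒≡ᵇ (suc (toℕ u)) (toℕ (nxt u)) (sym (toℕ-nxt-< u inside)))
  ... | no outside = T-∨ʳ {forward u (nxt u)} (T-∨ʳ {forward (nxt u) u} (T-∨ʳ {wrap u (nxt u)}
        (Equivalence.from T-∧ (≡⇒≡ᵇ _ 0 (toℕ-nxt-last u last) , ≡⇒≡ᵇ _ N last))))
    where
    last : suc (toℕ u) ≡ N
    last = ≤-antisym (FP.toℕ<n u) (≮⇒≥ outside)

  arc-sym : ∀ u v → T (arc D u v) → T (arc D v u)
  arc-sym u v = subst T (trans (x∙yz≈y∙xz (forward u v) (forward v u) _)
    (cong (λ b → forward v u ∨ (forward u v ∨ b)) (∨-comm (wrap u v) (wrap v u))))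
    where open import Algebra.Properties.CommutativeSemigroup
                        (CommutativeMonoid.commutativeSemigroup ∨-commutativeMonoid) using (x∙yz≈y∙xz)

  dist-lipschitz : ∀ y → Lipschitz {D} (λ u → dist u y)
  dist-lipschitz y u v a with arc⇒adjacent {u} {v} a
  ... | inj₁ refl = proj₁ (dist-nxt 1<N u y)
  ... | inj₂ refl = proj₂ (dist-nxt 1<N v y)

  -- the clockwise arc from u to nxt u gets colour u mod m
  module Colouring (m : ℕ) .{{_ : NonZero m}} where

    colouring : Colouring D m
    colouring u v with nxt u F.≟ v
    ... | yes _ = toℕ u mod m
    ... | no  _ = toℕ v mod m

    colouring-nxt : ∀ u → colouring u (nxt u) ≡ toℕ u mod m
    colouring-nxt u with nxt u F.≟ nxt u
    ... | yes _  = refl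
    ... | no ≢nxt = contradiction refl ≢nxt

    colouring-back : ∀ u → colouring (nxt u) u ≡ toℕ u mod m
    colouring-back u with nxt (nxt u) F.≟ u
    ... | yes nxt²≡ = contradiction nxt²≡ (⊕-≢ u z<s 2<N)
    ... | no _      = refl

    colouring-sym : ∀ u v → T (arc D u v) → colouring u v ≡ colouring v u
    colouring-sym u v a with arc⇒adjacent {u} {v} a
    ... | inj₁ refl = trans (colouring-nxt u) (sym (colouring-back u))
    ... | inj₂ refl = trans (colouring-back v) (sym (colouring-nxt v))

    module _ (N≤m+m : N ≤ m + m) (m+m≤1+N : m + m ≤ suc N) where

      window-distinct : ∀ a {d} → d + d ≤ N → DistinctBelow (λ j → colouring (a ⊕ j) (nxt (a ⊕ j))) d
      window-distinct a {d} 2d≤N {i} {j} i<j j<d same =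
        window-residues-distinct N≤m+m m+m≤1+N 2d≤N (FP.toℕ<n (a ⊕ i)) (m<n⇒0<n∸m i<j)
          (≤-<-trans (m∸n≤m j i) j<d) (begin
            (toℕ (a ⊕ i) + (j ∸ i)) % N % m   ≡⟨ cong (_% m) (toℕ-⊕ (a ⊕ i) (j ∸ i)) ⟨
            toℕ (a ⊕ i ⊕ (j ∸ i)) % m          ≡⟨ cong (λ x → toℕ x % m) (⊕-+ a i (j ∸ i)) ⟨
            toℕ (a ⊕ (i + (j ∸ i))) % m        ≡⟨ cong (λ x → toℕ (a ⊕ x) % m) (m+[n∸m]≡n (<⇒≤ i<j)) ⟩
            toℕ (a ⊕ j) % m                    ≡⟨ colour≡ j ⟨
            toℕ (colouring (a ⊕ j) (nxt (a ⊕ j)))  ≡⟨ cong toℕ same ⟨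
            toℕ (colouring (a ⊕ i) (nxt (a ⊕ i)))  ≡⟨ colour≡ i ⟩
            toℕ (a ⊕ i) % m                    ∎)
        where
        open ≡-Reasoning
        colour≡ : ∀ k → toℕ (colouring (a ⊕ k) (nxt (a ⊕ k))) ≡ toℕ (a ⊕ k) % m
        colour≡ k = trans (cong toℕ (colouring-nxt (a ⊕ k))) (FP.toℕ-fromℕ< _)

      strongly-rainbow-connected-colouring : StronglyRainbowConnected D colouring
      strongly-rainbow-connected-colouring =
        strongly-rainbow-connected colouring colouring-sym dist dist-lipschitz dist-self paths
        where
        open Reversal D arc-sym
        short : ∀ a {d} → d + d ≤ N → RainbowPath colouring a (a ⊕ d) d
        short a 2d≤N = clockwise-rainbowPath colouring a (m+m≤n⇒m<n (>-nonZero⁻¹ N) 2d≤N)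
                         (λ _ → arc-nxt _) (window-distinct a 2d≤N)
        paths : ∀ x y → x ≢ y →
                RainbowPath colouring x y (dist x y) ⊎ RainbowPath colouring y x (dist x y)
        paths x y x≢y with ⊓-sel (cwDist x y) (cwDist y x)
        ... | inj₁ d≡cw = inj₁ (subst (λ z → RainbowPath colouring x z (dist x y))
                                   (trans (cong (x ⊕_) d≡cw) (⊕-cwDist x y)) (short x (dist+dist≤N x≢y)))
        ... | inj₂ d≡cw = inj₂ (subst (λ z → RainbowPath colouring y z (dist x y))
                                   (trans (cong (y ⊕_) d≡cw) (⊕-cwDist y x)) (short y (dist+dist≤N x≢y)))

  dist≤len : ∀ {x y} (w : Walk D x y) → dist x y ≤ len w
  dist≤len {y = y} = lipschitz⇒≤len (dist-lipschitz y) (dist-self y)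

  origin : Fin N
  origin = fromℕ< (>-nonZero⁻¹ N)

  colours-lower-bound-antipodal : ∀ {t} → 0 < t → t + t ≤ N →
                                  ∀ k (c : Colouring D k) → RainbowConnected D c → t ≤ k
  colours-lower-bound-antipodal {t} 0<t 2t≤N k c =
    subst (_≤ k) (dist-⊕ origin 0<t 2t≤N)
      ∘ colours-lower-bound (⊕-≢ origin 0<t (m+m≤n⇒m<n (>-nonZero⁻¹ N) 2t≤N) ∘ sym) dist≤len c

  -- After stepping back from nxt v to v, the rest of the walk needs dist v y steps, and
  -- both ways around from v are too long.
  no-counterclockwise-start : ∀ {v y} (w : Walk D v y) → suc (len w) ≡ cwDist (nxt v) y →
                              ¬ (cwDist (nxt v) y + cwDist (nxt v) y < N)
  no-counterclockwise-start {v} {y} w len≡ short with v F.≟ y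
  ... | yes refl = contradiction (subst (_< 1) (sym len≡) c<1) λ { (s≤s ()) }
    where
    c : ℕ
    c = cwDist (nxt v) v
    c+1≡N : c + 1 ≡ N
    c+1≡N = trans (cong (c +_) (sym (cwDist-⊕ v 1<N))) (cwDist-sum (⊕-≢ v z<s 1<N))
    c<1 : c < 1
    c<1 = +-cancelˡ-< c c 1 (≤-trans short (≤-reflexive (sym c+1≡N)))
  ... | no v≢y with ⊓-sel (cwDist v y) (cwDist y v)
  ...   | inj₁ dist≡cw = 1+n≰n (≤-trans (n≤1+n (suc (len w))) (begin
      suc (suc (len w))         ≡⟨ cong suc len≡ ⟩
      suc (cwDist (nxt v) y)    ≡⟨ cwDist-nxtˡ v≢y ⟨
      cwDist v y                ≡⟨ dist≡cw ⟨
      dist v y                  ≤⟨ dist≤len w ⟩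
      len w                     ∎))
    where open ≤-Reasoning
  ...   | inj₂ dist≡ccw = <⇒≱ short (begin
      N                                      ≡⟨ cwDist-sum v≢y ⟨
      cwDist v y + cwDist y v                ≡⟨ cong (_+ cwDist y v) (cwDist-nxtˡ v≢y) ⟩
      suc (cwDist (nxt v) y) + cwDist y v    ≡⟨ +-suc (cwDist (nxt v) y) (cwDist y v) ⟨
      cwDist (nxt v) y + suc (cwDist y v)    ≤⟨ +-monoʳ-≤ (cwDist (nxt v) y) ccw<len ⟩
      cwDist (nxt v) y + cwDist (nxt v) y    ∎)
    where
    open ≤-Reasoning
    ccw<len : suc (cwDist y v) ≤ cwDist (nxt v) y
    ccw<len = subst (suc (cwDist y v) ≤_) len≡ (s≤s (subst (_≤ len w) dist≡ccw (dist≤len w)))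

  -- Walks of length cwDist u y < N / 2 from u to y are the clockwise ones.
  clockwise-geodesic-colours : ∀ {k} (c : Colouring D k) {u y} (w : Walk D u y) →
    len w ≡ cwDist u y → cwDist u y + cwDist u y < N →
    colours c w ≡ applyUpTo (λ j → c (u ⊕ j) (nxt (u ⊕ j))) (len w)
  clockwise-geodesic-colours c (stop _) _ _ = refl
  clockwise-geodesic-colours c {u} {y} (step {y = v} a w) len≡ short with arc⇒adjacent {u} {v} a
  ... | inj₂ refl = contradiction short (no-counterclockwise-start w len≡)
  ... | inj₁ refl = cong (c u (nxt u) ∷_) (clockwise-geodesic-colours c w len≡′ short′)
    where
    u≢y : u ≢ y
    u≢y refl = 0≢1+n (trans (sym (cwDist-self u)) (sym len≡))
    len≡′ : len w ≡ cwDist (nxt u) y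
    len≡′ = suc-injective (trans len≡ (cwDist-nxtˡ u≢y))
    short′ : cwDist (nxt u) y + cwDist (nxt u) y < N
    short′ = ≤-<-trans (+-mono-≤ (n≤1+n _) (n≤1+n _))
               (subst (λ x → x + x < N) (cwDist-nxtˡ u≢y) short)

  module OddCycle (t : ℕ) (N≡1+2t : N ≡ suc (t + t)) (2≤t : 2 ≤ t) where

    0<t : 0 < t
    0<t = ≤-trans (s≤s z≤n) 2≤t

    2t<N : t + t < N
    2t<N = ≤-reflexive (sym N≡1+2t)

    t<N : t < N
    t<N = m+m≤n⇒m<n (>-nonZero⁻¹ N) (<⇒≤ 2t<N)

    -- with t colours, the rainbow path from s to s ⊕ t is forced to be clockwise
    clockwise-windows-distinct : (c : Colouring D t) → RainbowConnected D c →
      ∀ s → DistinctBelow (λ j → c (s ⊕ j) (nxt (s ⊕ j))) t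
    clockwise-windows-distinct c rc s with rc s (s ⊕ t) (⊕-≢ s 0<t t<N ∘ sym)
    ... | w , _ , w! =
      unique-applyUpTo⁻ _ t (subst Unique (trans colours≡ (cong (applyUpTo _) len≡t)) w!)
      where
      cwDist≡t : cwDist s (s ⊕ t) ≡ t
      cwDist≡t = cwDist-⊕ s t<N
      len≡t : len w ≡ t
      len≡t = ≤-antisym (rainbow⇒len≤ c w w!) (subst (_≤ len w) (dist-⊕ s 0<t (<⇒≤ 2t<N)) (dist≤len w))
      colours≡ : colours c w ≡ applyUpTo (λ j → c (s ⊕ j) (nxt (s ⊕ j))) (len w)
      colours≡ = clockwise-geodesic-colours c w (trans len≡t (sym cwDist≡t))
                   (subst (λ x → x + x < N) (sym cwDist≡t) 2t<N)

    -- Every clockwise arc colour recurs t arcs later, and t + t + 1 = N brings it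
    -- back next to itself.
    not-rainbow-connected : (c : Colouring D t) → ¬ RainbowConnected D c
    not-rainbow-connected c rc = window origin z<s 2≤t full-turn
      where
      window : ∀ s → DistinctBelow (λ j → c (s ⊕ j) (nxt (s ⊕ j))) t
      window = clockwise-windows-distinct c rc
      arcColour : Fin N → Fin t
      arcColour s = c s (nxt s)
      period : ∀ s → arcColour s ≡ arcColour (s ⊕ t)
      period s = distinct-windows⇒periodic (λ j → arcColour (s ⊕ j)) (window s) (window (nxt s))
      full-turn : arcColour origin ≡ arcColour (nxt origin)
      full-turn = sym (begin
        arcColour (nxt origin)              ≡⟨ period (nxt origin) ⟩
        arcColour (nxt origin ⊕ t)          ≡⟨ period (nxt origin ⊕ t) ⟩
        arcColour (nxt origin ⊕ t ⊕ t)      ≡⟨ cong arcColour (⊕-+ origin (suc t) t) ⟨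
        arcColour (origin ⊕ (suc t + t))    ≡⟨ cong (λ x → arcColour (origin ⊕ x)) N≡1+2t ⟨
        arcColour (origin ⊕ N)              ≡⟨ cong arcColour (⊕-N origin) ⟩
        arcColour origin                    ∎)
        where open ≡-Reasoning

  colours-lower-bound-half : ∀ {q} → q + q ≡ N ⊎ q + q ≡ suc N →
                             ∀ k (c : Colouring D k) → RainbowConnected D c → q ≤ k
  colours-lower-bound-half {zero}  _            k c rc = z≤n
  colours-lower-bound-half {suc t} (inj₁ even) = colours-lower-bound-antipodal z<s (≤-reflexive even)
  colours-lower-bound-half {suc t} (inj₂ odd)  k c rc = ≤∧≢⇒< t≤k t≢k
    where
    N≡1+2t : N ≡ suc (t + t)
    N≡1+2t = sym (trans (sym (+-suc t t)) (suc-injective odd))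
    2≤t : 2 ≤ t
    2≤t = m+m≤1+n+n⇒m≤n (subst (4 ≤_) N≡1+2t 4≤N)
    t≤k : t ≤ k
    t≤k = colours-lower-bound-antipodal (≤-trans (s≤s z≤n) 2≤t)
            (≤-trans (n≤1+n (t + t)) (≤-reflexive (sym N≡1+2t))) k c rc
    t≢k : t ≢ k
    t≢k refl = OddCycle.not-rainbow-connected t N≡1+2t 2≤t c rc

  rc*-src* : ∀ q → q + q ≡ N ⊎ q + q ≡ suc N → RcStar (BiCycle N) q × SrcStar (BiCycle N) q
  rc*-src* zero (inj₁ 0≡N) = contradiction (subst (4 ≤_) (sym 0≡N) 4≤N) λ ()
  rc*-src* q@(suc _) half =
    rc*-src*-intro colouring (strongly-rainbow-connected-colouring N≤q+q q+q≤1+N)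
      (colours-lower-bound-half half)
    where
    open Colouring q
    N≤q+q : N ≤ q + q
    N≤q+q = [ ≤-reflexive ∘ sym , (λ e → ≤-trans (n≤1+n N) (≤-reflexive (sym e))) ]′ half
    q+q≤1+N : q + q ≤ suc N
    q+q≤1+N = [ (λ e → ≤-trans (≤-reflexive e) (n≤1+n N)) , ≤-reflexive ]′ half

module MultipartiteGraph (k : ℕ) (ns : Fin k → ℕ) where

  D : Digraph
  D = BiMultipartite k ns

  arc-between : ∀ {i j} (a : Fin (ns i)) (b : Fin (ns j)) → i ≢ j → T (arc D (i , a) (j , b))
  arc-between {i} {j} a b i≢j with i F.≟ j
  ... | yes i≡j = contradiction i≡j i≢j
  ... | no _    = _

  no-arc-within : ∀ {i} (a b : Fin (ns i)) → ¬ T (arc D (i , a) (i , b))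
  no-arc-within {i} a b with i F.≟ i
  ... | yes _  = λ ()
  ... | no i≢i = contradiction refl i≢i

  len-within : ∀ {i} {a b : Fin (ns i)} → a ≢ b → (w : Walk D (i , a) (i , b)) → 2 ≤ len w
  len-within a≢b (stop _)                   = contradiction refl a≢b
  len-within {a = a} {b} _ (step e (stop _)) = contradiction e (no-arc-within a b)
  len-within _ (step _ (step _ _))          = s≤s (s≤s z≤n)

  len-between : ∀ {x y} → x ≢ y → (w : Walk D x y) → 1 ≤ len w
  len-between x≢y (stop _)   = contradiction refl x≢y
  len-between x≢y (step _ _) = s≤s z≤n

  partOrder : Fin k → Fin k → Fin 2
  partOrder i j with i F.<? j
  ... | yes _ = F.zero
  ... | no _  = F.suc F.zero

  partOrder-≢ : ∀ {i j} → i ≢ j → partOrder i j ≢ partOrder j i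
  partOrder-≢ {i} {j} i≢j with i F.<? j | j F.<? i
  ... | yes i<j | yes j<i = contradiction j<i (FP.<-asym i<j)
  ... | yes _   | no _    = λ ()
  ... | no _    | yes _   = λ ()
  ... | no i≮j  | no j≮i  = contradiction (FP.≤-antisym (≮⇒≥ j≮i) (≮⇒≥ i≮j)) i≢j

  colouring : Colouring D 2
  colouring (i , _) (j , _) = partOrder i j

  another-part : 2 ≤ k → (i : Fin k) → ∃ λ j → i ≢ j
  another-part (s≤s (s≤s _)) F.zero    = F.suc F.zero , λ ()
  another-part (s≤s (s≤s _)) (F.suc _) = F.zero , λ ()

  strongly-rainbow-connected-colouring : 2 ≤ k → (∀ i → 1 ≤ ns i) → StronglyRainbowConnected D colouring
  strongly-rainbow-connected-colouring 2≤k nonempty (i , a) (j , b) x≢y with i F.≟ j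
  ... | no i≢j = step (arc-between a b i≢j) (stop _) , (x≢y ∷ []) ∷ [] ∷ [] ,
                 (λ w _ → len-between x≢y w) , [] ∷ []
  ... | yes refl = step (arc-between a z i≢j′) (step (arc-between z b (i≢j′ ∘ sym)) (stop _)) ,
                   (x≢z ∷ x≢y ∷ []) ∷ (z≢y ∷ []) ∷ [] ∷ [] ,
                   (λ w _ → len-within (x≢y ∘ cong (i ,_)) w) ,
                   (partOrder-≢ i≢j′ ∷ []) ∷ [] ∷ []
    where
    j′ : Fin k
    j′ = proj₁ (another-part 2≤k i)
    i≢j′ : i ≢ j′
    i≢j′ = proj₂ (another-part 2≤k i)
    z : Fin (ns j′)
    z = fromℕ< (nonempty j′)
    x≢z : (i , a) ≢ (j′ , z)
    x≢z = i≢j′ ∘ cong proj₁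
    z≢y : (j′ , z) ≢ (i , b)
    z≢y = i≢j′ ∘ sym ∘ cong proj₁

  colours-lower-bound-within : (∃ λ i → 2 ≤ ns i) →
                               ∀ m (c : Colouring D m) → RainbowConnected D c → 2 ≤ m
  colours-lower-bound-within (i , 2≤nsi) m c =
    colours-lower-bound {x = i , a} {y = i , b} (0≢1 ∘ cong (toℕ ∘ proj₂))
      (len-within (0≢1 ∘ cong toℕ)) c
    where
    a b : Fin (ns i)
    a = fromℕ< (≤-trans (s≤s z≤n) 2≤nsi)
    b = fromℕ< 2≤nsi
    0≢1 : toℕ a ≢ toℕ b
    0≢1 eq with trans (sym (FP.toℕ-fromℕ< _)) (trans eq (FP.toℕ-fromℕ< _))
    ... | ()

  rc*-src* : 2 ≤ k → (∀ i → 1 ≤ ns i) → (∃ λ i → 2 ≤ ns i) →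
             RcStar (BiMultipartite k ns) 2 × SrcStar (BiMultipartite k ns) 2
  rc*-src* 2≤k nonempty big =
    rc*-src*-intro colouring (strongly-rainbow-connected-colouring 2≤k nonempty)
      (colours-lower-bound-within big)

theorem3 :
      ((n : ℕ) → 2 ≤ n → RcStar (BiPath n) (n ∸ 1) × SrcStar (BiPath n) (n ∸ 1))
    × ((n : ℕ) → 4 ≤ n → RcStar (BiCycle n) ((n + 1) / 2) × SrcStar (BiCycle n) ((n + 1) / 2))
    × ((k : ℕ) (ns : Fin k → ℕ) → 2 ≤ k → ((i : Fin k) → 1 ≤ ns i) → (∃ λ i → 2 ≤ ns i)
        → RcStar (BiMultipartite k ns) 2 × SrcStar (BiMultipartite k ns) 2)
theorem3 = path , cycle , MultipartiteGraph.rc*-src*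
  where
  path : (n : ℕ) → 2 ≤ n → RcStar (BiPath n) (n ∸ 1) × SrcStar (BiPath n) (n ∸ 1)
  path (suc (suc n)) _ = PathGraph.rc*-src* n
  path 1 (s≤s ())
  cycle : (n : ℕ) → 4 ≤ n → RcStar (BiCycle n) ((n + 1) / 2) × SrcStar (BiCycle n) ((n + 1) / 2)
  cycle n 4≤n = CycleGraph.rc*-src* n 4≤n ((n + 1) / 2) ([n+1]/2-double n)
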